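{- $\mathit{ORD}:\mathsf n\mathsf{PROP}\to\mathsf{PROP}$ is a functor, mapping an arrow of nominal $\mathsf{PROP}$s $F:\mathcal T\to\mathcal T'$ to the arrow of $\mathsf{PROP}$s $\mathit{ORD}(F):\mathit{ORD}(\mathcal T)\to\mathit{ORD}(\mathcal T')$ defined by $\mathit{ORD}(F)(\langle\boldsymbol a]f[\boldsymbol b\rangle)=\langle\boldsymbol a]Ff[\boldsymbol b\rangle$.
   Context: $\mathcal N$ is a countably infinite set of names. A $\mathsf{PROP}$ (MacLane) is a symmetric strict monoidal category with objects the natural numbers $\underline n$, tensor $\oplus$ given by addition on objects, composition $;$ (diagrammatic order), symmetries satisfying the symmetric strict monoidal laws including naturality of symmetries. $\mathsf{PROP}$ is the category of $\mathsf{PROP}$s with identity-on-objects strict symmetric monoidal functors. A nominal $\mathsf{PROP}$ is a small category with objects the finite subsets of $\mathcal N$, partial tensor $\uplus$ (union of disjoint sets; $f\uplus g$ defined iff domains disjoint and codomains disjoint), commutative and associative with unit $\emptyset$, satisfying identity/associativity and interchange whenever both sides are defined, containing all bijections $\pi_A:A\to\pi[A]$ for finite permutations $\pi$, with permutation action $\pi\cdot f=(\pi_A)^{ -1};f;\pi_B$. $\mathsf n\mathsf{PROP}$ is the category of nominal $\mathsf{PROP}$s with identity-on-objects, strict monoidal, equivariant functors. For a nominal $\mathsf{PROP}$ $\mathcal T$, $\mathit{ORD}(\mathcal T)$ is the $\mathsf{PROP}$ with arrows $\langle\boldsymbol a]f[\boldsymbol b\rangle:\underline n\to\underline m$ for $f:A\to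 B$ in $\mathcal T$ and lists $\boldsymbol a,\boldsymbol b$ of pairwise distinct names enumerating $A$ (length $n$) and $B$ (length $m$), subject to: $\langle\boldsymbol a]f;g[\boldsymbol c\rangle=\langle\boldsymbol a]f[\boldsymbol b\rangle;\langle\boldsymbol b]g[\boldsymbol c\rangle$; $\langle\boldsymbol a_f+\boldsymbol a_g]f\uplus g[\boldsymbol b_f+\boldsymbol b_g\rangle=\langle\boldsymbol a_f]f[\boldsymbol b_f\rangle\oplus\langle\boldsymbol a_g]g[\boldsymbol b_g\rangle$; $\langle\boldsymbol a]\mathit{id}[\boldsymbol a\rangle=\mathit{id}$; $\langle\boldsymbol a][\boldsymbol a'|\boldsymbol b];f[\boldsymbol c\rangle=\langle\boldsymbol a|\boldsymbol a'\rangle;\langle\boldsymbol b]f[\boldsymbol c\rangle$; $\langle\boldsymbol a]f;[\boldsymbol b|\boldsymbol c][\boldsymbol c'\rangle=\langle\boldsymbol a]f[\boldsymbol b\rangle;\langle\boldsymbol c|\boldsymbol c'\rangle$. Here $+$ is list concatenation, $\langle\boldsymbol a|\boldsymbol a'\rangle$ is the symmetry mapping $i\mapsto j$ where $a_i=a'_j$, and $[\boldsymbol a|\boldsymbol b]=\biguplus_i\delta_{a_ib_i}$ with $\delta_{ab}:\{a\}\to\{b\}$ the bijection. -}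

module Defs where

open import Level using (Level; _⊔_) renaming (suc to lsuc)
open import Data.Nat using (ℕ; zero; suc; _+_; _≤_; _<_; _≟_) renaming (_⊔_ to _⊔ₙ_)
open import Data.Nat.Properties using (m≤m⊔n; m≤n⊔m; ≤-trans)
open import Data.Fin using (Fin; zero; suc)
open import Data.List using (List; []; _∷_)
open import Data.List.Membership.Propositional using (_∈_)
open import Data.List.Relation.Unary.Linked using (Linked; []; [-])
open import Data.List.Relation.Binary.Permutation.Propositional using (_↭_)
open import Data.Vec using (Vec; []; _∷_; _++_; toList; removeAt)
open import Data.Product using (Σ; ∃; _×_; _,_)
open import Data.Sum using (_⊎_)
open import Data.Empty using (⊥)
open import Relation.Nullary using (yes; no)
open import Relation.Binary using (Rel; IsEquivalence)
open import Relation.Binary.PropositionalEquality using (_≡_; refl; trans; cong; sym)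

Name : Set
Name = ℕ

-- Finite subsets of 𝒩, canonically represented by strictly increasing
-- lists (so two finite sets are equal iff their representations are ≡).
record FSet : Set where
  constructor fset
  field
    elems  : List Name
    sorted : Linked _<_ elems

_∈ˢ_ : Name → FSet → Set
x ∈ˢ A = x ∈ FSet.elems A

∅ : FSet
∅ = fset [] []

⟦_⟧ : Name → FSet
⟦ x ⟧ = fset (x ∷ []) [-]

record DU (A C E : FSet) : Set where
  field
    du-split : ∀ x → x ∈ˢ E → x ∈ˢ A ⊎ x ∈ˢ C
    du-inl   : ∀ x → x ∈ˢ A → x ∈ˢ E
    du-inr   : ∀ x → x ∈ˢ C → x ∈ˢ E
    du-disj  : ∀ x → x ∈ˢ A → x ∈ˢ C → ⊥

record FinPerm : Set where
  field
    to      : Name → Name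
    from    : Name → Name
    to-from : ∀ x → to (from x) ≡ x
    from-to : ∀ x → from (to x) ≡ x
    bound   : ℕ
    support : ∀ x → bound ≤ x → to x ≡ x

idP : FinPerm
idP = record { to = λ x → x ; from = λ x → x ; to-from = λ _ → refl
             ; from-to = λ _ → refl ; bound = 0 ; support = λ _ _ → refl }

invP : FinPerm → FinPerm
invP π = record
  { to = from ; from = to ; to-from = from-to ; from-to = to-from
  ; bound = bound
  ; support = λ x b≤x → trans (cong from (sym (support x b≤x))) (from-to x) }
  where open FinPerm π

_∘P_ : FinPerm → FinPerm → FinPerm
ρ ∘P π = record
  { to = λ x → R.to (P.to x)
  ; from = λ x → P.from (R.from x)
  ; to-from = λ x → trans (cong R.to (P.to-from (R.from x))) (R.to-from x)
  ; from-to = λ x → trans (cong P.from (R.from-to (P.to x))) (P.from-to x)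
  ; bound = R.bound ⊔ₙ P.bound
  ; support = λ x b≤x →
      trans (cong R.to (P.support x (≤-trans (m≤n⊔m R.bound P.bound) b≤x)))
            (R.support x (≤-trans (m≤m⊔n R.bound P.bound) b≤x)) }
  where module R = FinPerm ρ
        module P = FinPerm π

record Img (π : FinPerm) (A B : FSet) : Set where
  field
    img-to   : ∀ x → x ∈ˢ A → FinPerm.to π x ∈ˢ B
    img-onto : ∀ y → y ∈ˢ B → ∃ λ x → x ∈ˢ A × FinPerm.to π x ≡ y

record Enum {n} (a : Vec Name n) (A : FSet) : Set where
  field
    enum : toList a ↭ FSet.elems A

-- Hom-sets are setoids (no quotients in Agda).  The partial tensor ⊎ is
-- given relationally: tensor f g p q : Hom E G  is  f ⊎ g  where
-- p : E = A ⊎ C and q : G = B ⊎ D witness disjointness of (co)domains.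
record NominalPROP (ℓ ℓ' : Level) : Set (lsuc (ℓ ⊔ ℓ')) where
  infixr 9 _⨾_
  infix 4 _≈_
  field
    Hom     : FSet → FSet → Set ℓ
    _≈_     : ∀ {A B} → Rel (Hom A B) ℓ'
    ≈-equiv : ∀ {A B} → IsEquivalence (_≈_ {A} {B})
    id      : ∀ {A} → Hom A A
    _⨾_     : ∀ {A B C} → Hom A B → Hom B C → Hom A C
    ⨾-cong  : ∀ {A B C} {f f' : Hom A B} {g g' : Hom B C} →
              f ≈ f' → g ≈ g' → f ⨾ g ≈ f' ⨾ g'
    idˡ     : ∀ {A B} (f : Hom A B) → id ⨾ f ≈ f
    idʳ     : ∀ {A B} (f : Hom A B) → f ⨾ id ≈ f
    assoc   : ∀ {A B C D} (f : Hom A B) (g : Hom B C) (h : Hom C D) →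
              (f ⨾ g) ⨾ h ≈ f ⨾ (g ⨾ h)
    tensor  : ∀ {A B C D E G} → Hom A B → Hom C D → DU A C E → DU B D G → Hom E G
    tensor-cong : ∀ {A B C D E G} {f f' : Hom A B} {g g' : Hom C D}
                  (p : DU A C E) (q : DU B D G) →
                  f ≈ f' → g ≈ g' → tensor f g p q ≈ tensor f' g' p q
    tensor-comm : ∀ {A B C D E G} (f : Hom A B) (g : Hom C D)
                  (p : DU A C E) (q : DU B D G) (p' : DU C A E) (q' : DU D B G) →
                  tensor f g p q ≈ tensor g f p' q'
    tensor-assoc : ∀ {A₁ B₁ A₂ B₂ A₃ B₃ A₁₂ B₁₂ A₂₃ B₂₃ A B}
                   (f : Hom A₁ B₁) (g : Hom A₂ B₂) (h : Hom A₃ B₃)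
                   (p₁₂ : DU A₁ A₂ A₁₂) (q₁₂ : DU B₁ B₂ B₁₂)
                   (p : DU A₁₂ A₃ A) (q : DU B₁₂ B₃ B)
                   (p₂₃ : DU A₂ A₃ A₂₃) (q₂₃ : DU B₂ B₃ B₂₃)
                   (p' : DU A₁ A₂₃ A) (q' : DU B₁ B₂₃ B) →
                   tensor (tensor f g p₁₂ q₁₂) h p q ≈ tensor f (tensor g h p₂₃ q₂₃) p' q'
    tensor-unit : ∀ {A B} (f : Hom A B) (p : DU A ∅ A) (q : DU B ∅ B) →
                  tensor f (id {∅}) p q ≈ f
    tensor-id   : ∀ {A C E} (p : DU A C E) → tensor (id {A}) (id {C}) p p ≈ id {E}
    interchange : ∀ {A B C A' B' C' E G K}
                  (f : Hom A B) (g : Hom B C) (f' : Hom A' B') (g' : Hom B' C')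
                  (p : DU A A' E) (q : DU B B' G) (r : DU C C' K) →
                  tensor (f ⨾ g) (f' ⨾ g') p r ≈ tensor f f' p q ⨾ tensor g g' q r
    perm        : ∀ (π : FinPerm) {A B} → Img π A B → Hom A B
    perm-local  : ∀ (π ρ : FinPerm) {A B} (i : Img π A B) (j : Img ρ A B) →
                  (∀ x → x ∈ˢ A → FinPerm.to π x ≡ FinPerm.to ρ x) →
                  perm π i ≈ perm ρ j
    perm-id     : ∀ {A} (i : Img idP A A) → perm idP i ≈ id
    perm-comp   : ∀ (π ρ : FinPerm) {A B C} (i : Img π A B) (j : Img ρ B C)
                  (k : Img (ρ ∘P π) A C) → perm π i ⨾ perm ρ j ≈ perm (ρ ∘P π) k
    perm-tensor : ∀ (π : FinPerm) {A B C D E G} (i : Img π A B) (j : Img π C D)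
                  (p : DU A C E) (q : DU B D G) (k : Img π E G) →
                  tensor (perm π i) (perm π j) p q ≈ perm π k

module _ {ℓ ℓ'} (T : NominalPROP ℓ ℓ') where
  open NominalPROP T

  -- permutation action  π · f = (π_A)⁻¹ ; f ; π_B   (with (π_A)⁻¹ = (π⁻¹)_{π[A]})
  act : ∀ (π : FinPerm) {A A' B B'} → Img (invP π) A' A → Img π B B' →
        Hom A B → Hom A' B'
  act π i j f = perm (invP π) i ⨾ (f ⨾ perm π j)

record NHom {ℓ₁ ℓ₁' ℓ₂ ℓ₂'} (T : NominalPROP ℓ₁ ℓ₁') (T' : NominalPROP ℓ₂ ℓ₂')
  : Set (ℓ₁ ⊔ ℓ₁' ⊔ ℓ₂ ⊔ ℓ₂') where
  private
    module S = NominalPROP T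
    module S' = NominalPROP T'
  field
    map        : ∀ {A B} → S.Hom A B → S'.Hom A B
    map-cong   : ∀ {A B} {f g : S.Hom A B} → f S.≈ g → map f S'.≈ map g
    map-id     : ∀ {A} → map (S.id {A}) S'.≈ S'.id
    map-⨾      : ∀ {A B C} (f : S.Hom A B) (g : S.Hom B C) →
                 map (f S.⨾ g) S'.≈ map f S'.⨾ map g
    map-tensor : ∀ {A B C D E G} (f : S.Hom A B) (g : S.Hom C D)
                 (p : DU A C E) (q : DU B D G) →
                 map (S.tensor f g p q) S'.≈ S'.tensor (map f) (map g) p q
    map-equiv  : ∀ (π : FinPerm) {A A' B B'} (i : Img (invP π) A' A) (j : Img π B B')
                 (f : S.Hom A B) → map (act T π i j f) S'.≈ act T' π i j (map f)

idN : ∀ {ℓ ℓ'} (T : NominalPROP ℓ ℓ') → NHom T T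
idN T = record
  { map = λ f → f ; map-cong = λ e → e ; map-id = refl′
  ; map-⨾ = λ _ _ → refl′ ; map-tensor = λ _ _ _ _ → refl′
  ; map-equiv = λ _ _ _ _ → refl′ }
  where open NominalPROP T
        refl′ : ∀ {A B} {f : Hom A B} → f ≈ f
        refl′ = IsEquivalence.refl ≈-equiv

_∘N_ : ∀ {a a' b b' c c'} {T₁ : NominalPROP a a'} {T₂ : NominalPROP b b'}
       {T₃ : NominalPROP c c'} → NHom T₂ T₃ → NHom T₁ T₂ → NHom T₁ T₃
_∘N_ {T₁ = T₁} {T₃ = T₃} G F = record
  { map = λ f → G.map (F.map f)
  ; map-cong = λ e → G.map-cong (F.map-cong e)
  ; map-id = tr (G.map-cong F.map-id) G.map-id
  ; map-⨾ = λ f g → tr (G.map-cong (F.map-⨾ f g)) (G.map-⨾ (F.map f) (F.map g))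
  ; map-tensor = λ f g p q → tr (G.map-cong (F.map-tensor f g p q)) (G.map-tensor (F.map f) (F.map g) p q)
  ; map-equiv = eqv }
  where module G = NHom G
        module F = NHom F
        open NominalPROP T₃
        tr : ∀ {A B} {f g h : Hom A B} → f ≈ g → g ≈ h → f ≈ h
        tr = IsEquivalence.trans ≈-equiv
        eqv : ∀ (π : FinPerm) {A A' B B'} (i : Img (invP π) A' A) (j : Img π B B')
              (f : NominalPROP.Hom T₁ A B) →
              G.map (F.map (act T₁ π i j f)) ≈ act T₃ π i j (G.map (F.map f))
        eqv π i j f = tr (G.map-cong (F.map-equiv π i j f)) (G.map-equiv π i j (F.map f))

-- Ren a b A B : a enumerates A, b enumerates B, and A = ⊎ᵢ {aᵢ}, B = ⊎ᵢ {bᵢ}.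
-- δ_{xy} : {x} → {y} is the bijection, given as π_{x} for some π with π x = y.
data Ren : ∀ {n} → Vec Name n → Vec Name n → FSet → FSet → Set where
  ren[] : Ren [] [] ∅ ∅
  ren∷  : ∀ {n x y} {a b : Vec Name n} {A B A' B'} (π : FinPerm) →
          Img π ⟦ x ⟧ ⟦ y ⟧ → DU ⟦ x ⟧ A A' → DU ⟦ y ⟧ B B' →
          Ren a b A B → Ren (x ∷ a) (y ∷ b) A' B'

ren : ∀ {ℓ ℓ'} (T : NominalPROP ℓ ℓ') {n} {a b : Vec Name n} {A B} →
      Ren a b A B → NominalPROP.Hom T A B
ren T ren[] = NominalPROP.id T
ren T (ren∷ π i p q r) = NominalPROP.tensor T (NominalPROP.perm T π i) (ren T r) p q

-- ORD(T): the PROP presented by generators ⟨a]f[b⟩ and relations.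
-- Arrows n → m are terms of the free PROP on these generators, modulo the
-- congruence generated by the PROP laws and the relations of ORD.
-- The symmetries of a PROP are generated by the crossing σ : 2 → 2.

module _ {ℓ ℓ'} (T : NominalPROP ℓ ℓ') where
  open NominalPROP T

  infixr 9 _⨾ᵀ_
  infixr 10 _⊕_

  data Term : ℕ → ℕ → Set ℓ where
    gen   : ∀ {n m A B} (a : Vec Name n) (b : Vec Name m) →
            .(Enum a A) → .(Enum b B) → Hom A B → Term n m
    idᵀ   : ∀ {n} → Term n n
    _⨾ᵀ_  : ∀ {n m k} → Term n m → Term m k → Term n k
    _⊕_   : ∀ {n m n' m'} → Term n m → Term n' m' → Term (n + n') (m + m')
    σ     : Term 2 2

  cross : ∀ n → Term (n + 1) (1 + n)
  cross zero = idᵀ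
  cross (suc n) = (idᵀ {1} ⊕ cross n) ⨾ᵀ (σ ⊕ idᵀ {n})

  -- move k : wire 0 goes to position k, wires 1..k shift down by one
  move : ∀ {n} → Fin (suc n) → Term (suc n) (suc n)
  move zero = idᵀ
  move {suc n} (suc k) = (σ ⊕ idᵀ {n}) ⨾ᵀ (idᵀ {1} ⊕ move k)

  indexOf : ∀ {n} → Name → Vec Name (suc n) → Fin (suc n)
  indexOf x (y ∷ ys) with x ≟ y
  ... | yes _ = zero
  indexOf x (y ∷ []) | no _ = zero
  indexOf x (y ∷ (z ∷ zs)) | no _ = suc (indexOf x (z ∷ zs))

  -- ⟨a|a'⟩ : the symmetry mapping i ↦ j where aᵢ = a'ⱼ
  -- (meaningful when a' is a rearrangement of the distinct names a)
  symᵀ : ∀ {n} → Vec Name n → Vec Name n → Term n n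
  symᵀ [] [] = idᵀ
  symᵀ (x ∷ a) a' = (idᵀ {1} ⊕ symᵀ a (removeAt a' k)) ⨾ᵀ move k
    where k = indexOf x a'

  infix 4 _≈ᵀ_
  -- heterogeneous in the indices to avoid casts along n+(m+k) ≡ (n+m)+k;
  -- equality of arrows n → m is the restriction to Term n m.
  data _≈ᵀ_ : ∀ {n m n' m'} → Term n m → Term n' m' → Set (ℓ ⊔ ℓ') where
    ≈refl  : ∀ {n m} {t : Term n m} → t ≈ᵀ t
    ≈sym   : ∀ {n m n' m'} {t : Term n m} {u : Term n' m'} → t ≈ᵀ u → u ≈ᵀ t
    ≈trans : ∀ {n m n' m' n'' m''} {t : Term n m} {u : Term n' m'} {v : Term n'' m''} →
             t ≈ᵀ u → u ≈ᵀ v → t ≈ᵀ v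
    ⨾ᵀ-cong : ∀ {n m k n' m' k'} {f : Term n m} {g : Term m k} {f' : Term n' m'} {g' : Term m' k'} →
             f ≈ᵀ f' → g ≈ᵀ g' → f ⨾ᵀ g ≈ᵀ f' ⨾ᵀ g'
    ⊕-cong : ∀ {n m k l n' m' k' l'} {f : Term n m} {g : Term k l} {f' : Term n' m'} {g' : Term k' l'} →
             f ≈ᵀ f' → g ≈ᵀ g' → f ⊕ g ≈ᵀ f' ⊕ g'
    idˡᵀ   : ∀ {n m} (f : Term n m) → idᵀ ⨾ᵀ f ≈ᵀ f
    idʳᵀ   : ∀ {n m} (f : Term n m) → f ⨾ᵀ idᵀ ≈ᵀ f
    assocᵀ : ∀ {n m k l} (f : Term n m) (g : Term m k) (h : Term k l) →
             (f ⨾ᵀ g) ⨾ᵀ h ≈ᵀ f ⨾ᵀ (g ⨾ᵀ h)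
    ⊕-assoc : ∀ {n m n' m' n'' m''} (f : Term n m) (g : Term n' m') (h : Term n'' m'') →
              (f ⊕ g) ⊕ h ≈ᵀ f ⊕ (g ⊕ h)
    ⊕-unitˡ : ∀ {n m} (f : Term n m) → idᵀ {0} ⊕ f ≈ᵀ f
    ⊕-unitʳ : ∀ {n m} (f : Term n m) → f ⊕ idᵀ {0} ≈ᵀ f
    ⊕-id    : ∀ {n m} → idᵀ {n} ⊕ idᵀ {m} ≈ᵀ idᵀ {n + m}
    ⊕-interchange : ∀ {n m k n' m' k'} (f : Term n m) (g : Term m k)
                    (f' : Term n' m') (g' : Term m' k') →
                    (f ⨾ᵀ g) ⊕ (f' ⨾ᵀ g') ≈ᵀ (f ⊕ f') ⨾ᵀ (g ⊕ g')
    σ-inv  : σ ⨾ᵀ σ ≈ᵀ idᵀ {2}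
    σ-ybe  : (σ ⊕ idᵀ {1}) ⨾ᵀ (idᵀ {1} ⊕ σ) ⨾ᵀ (σ ⊕ idᵀ {1})
             ≈ᵀ (idᵀ {1} ⊕ σ) ⨾ᵀ (σ ⊕ idᵀ {1}) ⨾ᵀ (idᵀ {1} ⊕ σ)
    σ-nat  : ∀ {n m} (f : Term n m) →
             (f ⊕ idᵀ {1}) ⨾ᵀ cross m ≈ᵀ cross n ⨾ᵀ (idᵀ {1} ⊕ f)
    gen-cong : ∀ {n m A B} (a : Vec Name n) (b : Vec Name m) (ea : Enum a A) (eb : Enum b B)
               {f f' : Hom A B} → f ≈ f' → gen a b ea eb f ≈ᵀ gen a b ea eb f'
    rel-⨾  : ∀ {n m k A B C} (a : Vec Name n) (b : Vec Name m) (c : Vec Name k)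
             (ea : Enum a A) (eb : Enum b B) (ec : Enum c C) (f : Hom A B) (g : Hom B C) →
             gen a c ea ec (f ⨾ g) ≈ᵀ gen a b ea eb f ⨾ᵀ gen b c eb ec g
    rel-⊎  : ∀ {n m n' m' A B C D E G}
             (af : Vec Name n) (bf : Vec Name m) (ag : Vec Name n') (bg : Vec Name m')
             (eaf : Enum af A) (ebf : Enum bf B) (eag : Enum ag C) (ebg : Enum bg D)
             (ea : Enum (af ++ ag) E) (eb : Enum (bf ++ bg) G)
             (f : Hom A B) (g : Hom C D) (p : DU A C E) (q : DU B D G) →
             gen (af ++ ag) (bf ++ bg) ea eb (tensor f g p q)
               ≈ᵀ gen af bf eaf ebf f ⊕ gen ag bg eag ebg g
    rel-id : ∀ {n A} (a : Vec Name n) (ea : Enum a A) → gen a a ea ea (id {A}) ≈ᵀ idᵀ {n}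
    rel-renˡ : ∀ {n m A B C} (a a' b : Vec Name n) (c : Vec Name m)
               (r : Ren a' b A B) (ea : Enum a A) (eb : Enum b B) (ec : Enum c C)
               (f : Hom B C) →
               gen a c ea ec (ren T r ⨾ f) ≈ᵀ symᵀ a a' ⨾ᵀ gen b c eb ec f
    rel-renʳ : ∀ {n m A B C} (a : Vec Name n) (b c c' : Vec Name m)
               (r : Ren b c B C) (ea : Enum a A) (eb : Enum b B) (ec' : Enum c' C)
               (f : Hom A B) →
               gen a c' ea ec' (f ⨾ ren T r) ≈ᵀ gen a b ea eb f ⨾ᵀ symᵀ c c'

ordMap : ∀ {ℓ₁ ℓ₁' ℓ₂ ℓ₂'} {T : NominalPROP ℓ₁ ℓ₁'} {T' : NominalPROP ℓ₂ ℓ₂'} →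
         NHom T T' → ∀ {n m} → Term T n m → Term T' n m
ordMap F (gen a b ea eb f) = gen a b ea eb (NHom.map F f)
ordMap F idᵀ = idᵀ
ordMap F (t ⨾ᵀ u) = ordMap F t ⨾ᵀ ordMap F u
ordMap F (t ⊕ u) = ordMap F t ⊕ ordMap F u
ordMap F σ = σ

record IsPROPArrow {ℓ₁ ℓ₁' ℓ₂ ℓ₂'} (T : NominalPROP ℓ₁ ℓ₁') (T' : NominalPROP ℓ₂ ℓ₂')
  (Φ : ∀ {n m} → Term T n m → Term T' n m) : Set (ℓ₁ ⊔ ℓ₁' ⊔ ℓ₂ ⊔ ℓ₂') where
  field
    resp  : ∀ {n m} {t u : Term T n m} → _≈ᵀ_ T t u → _≈ᵀ_ T' (Φ t) (Φ u)
    pres-id : ∀ {n} → _≈ᵀ_ T' (Φ (idᵀ {n = n})) (idᵀ {n = n})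
    pres-⨾  : ∀ {n m k} (t : Term T n m) (u : Term T m k) →
              _≈ᵀ_ T' (Φ (t ⨾ᵀ u)) (Φ t ⨾ᵀ Φ u)
    pres-⊕  : ∀ {n m n' m'} (t : Term T n m) (u : Term T n' m') →
              _≈ᵀ_ T' (Φ (t ⊕ u)) (Φ t ⊕ Φ u)
    pres-σ  : _≈ᵀ_ T' (Φ σ) σ

-- ORD(F) is defined on terms, so identities, composition and the PROP structure
-- are preserved on the nose; the content is that ORD(F) respects the relations of
-- ORD(T). All of them are images of equations of T, except the renaming relations,
-- which need F [a|b] ≈ [a|b]: a strict monoidal functor reduces this to the
-- singleton bijections δ_{xy}, and equivariance forces F to fix those.
module Submission where

open import Defs
open import Data.Product using (_×_; _,_)
open import Data.Nat using (zero; suc; _≟_; _⊔_)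
open import Data.Nat.Properties using (≤-refl; >⇒≢; m⊔n<o⇒m<o; m⊔n<o⇒n<o)
open import Data.List.Relation.Unary.Any using (here)
open import Data.Vec using (Vec; []; _∷_; removeAt)
open import Data.Fin using (Fin; zero; suc)
open import Data.Empty using (⊥-elim)
open import Relation.Nullary using (yes; no)
open import Relation.Binary using (Setoid; IsEquivalence)
open import Relation.Binary.PropositionalEquality
  using (_≡_; _≢_; refl; trans; cong; cong₂; sym; subst; subst₂)
import Relation.Binary.Reasoning.Setoid as SetoidReasoning

transpose : Name → Name → Name → Name
transpose a b x with x ≟ a
... | yes _ = b
... | no _ with x ≟ b
...   | yes _ = a
...   | no _ = x

transpose-applyˡ : ∀ a b → transpose a b a ≡ b
transpose-applyˡ a b with a ≟ a
... | yes _ = refl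
... | no a≢a = ⊥-elim (a≢a refl)

transpose-applyʳ : ∀ a b → transpose a b b ≡ a
transpose-applyʳ a b with b ≟ a
... | yes b≡a = b≡a
... | no _ with b ≟ b
...   | yes _ = refl
...   | no b≢b = ⊥-elim (b≢b refl)

transpose-fix : ∀ a b x → x ≢ a → x ≢ b → transpose a b x ≡ x
transpose-fix a b x x≢a x≢b with x ≟ a
... | yes x≡a = ⊥-elim (x≢a x≡a)
... | no _ with x ≟ b
...   | yes x≡b = ⊥-elim (x≢b x≡b)
...   | no _ = refl

transpose-involutive : ∀ a b x → transpose a b (transpose a b x) ≡ x
transpose-involutive a b x with x ≟ a
... | yes x≡a = trans (transpose-applyʳ a b) (sym x≡a)
... | no x≢a with x ≟ b
...   | yes x≡b = trans (transpose-applyˡ a b) (sym x≡b)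
...   | no x≢b = transpose-fix a b x x≢a x≢b

transposeP : Name → Name → FinPerm
transposeP a b = record
  { to = transpose a b ; from = transpose a b
  ; to-from = transpose-involutive a b ; from-to = transpose-involutive a b
  ; bound = suc (a ⊔ b)
  ; support = λ x a⊔b<x →
      transpose-fix a b x (>⇒≢ (m⊔n<o⇒m<o a b a⊔b<x)) (>⇒≢ (m⊔n<o⇒n<o a b a⊔b<x)) }

Img-⟦⟧ : ∀ (π : FinPerm) {x y} → FinPerm.to π x ≡ y → Img π ⟦ x ⟧ ⟦ y ⟧
Img-⟦⟧ π {x} πx≡y = record
  { img-to = λ { _ (here refl) → here πx≡y }
  ; img-onto = λ { _ (here refl) → x , here refl , πx≡y } }

Img-idP : ∀ A → Img idP A A
Img-idP A = record { img-to = λ _ x∈A → x∈A ; img-onto = λ y y∈A → y , y∈A , refl }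

Img-∘P-invP : ∀ (ρ : FinPerm) A → Img (ρ ∘P invP ρ) A A
Img-∘P-invP ρ A = record
  { img-to = λ x x∈A → subst (_∈ˢ A) (sym (FinPerm.to-from ρ x)) x∈A
  ; img-onto = λ y y∈A → y , y∈A , FinPerm.to-from ρ y }

module NominalPROPProperties {ℓ ℓ'} (T : NominalPROP ℓ ℓ') where
  open NominalPROP T

  homSetoid : FSet → FSet → Setoid ℓ ℓ'
  homSetoid A B = record { Carrier = Hom A B ; _≈_ = _≈_ ; isEquivalence = ≈-equiv }

  module HomReasoning {A B} = SetoidReasoning (homSetoid A B)
  open HomReasoning

  ≈-refl : ∀ {A B} {f : Hom A B} → f ≈ f
  ≈-refl = IsEquivalence.refl ≈-equiv

  ≈-trans : ∀ {A B} {f g h : Hom A B} → f ≈ g → g ≈ h → f ≈ h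
  ≈-trans = IsEquivalence.trans ≈-equiv

  perm-fix : ∀ π {A} (i : Img π A A) → (∀ x → x ∈ˢ A → FinPerm.to π x ≡ x) →
             perm π i ≈ id
  perm-fix π {A} i πx≡x = begin
    perm π i                  ≈⟨ perm-local π idP i (Img-idP A) πx≡x ⟩
    perm idP (Img-idP A)      ≈⟨ perm-id _ ⟩
    id                        ∎

  perm-invˡ : ∀ ρ {A B} (i : Img ρ A B) (j : Img (invP ρ) B A) →
              perm (invP ρ) j ⨾ perm ρ i ≈ id
  perm-invˡ ρ {B = B} i j = begin
    perm (invP ρ) j ⨾ perm ρ i                 ≈⟨ perm-comp (invP ρ) ρ j i (Img-∘P-invP ρ B) ⟩
    perm (ρ ∘P invP ρ) (Img-∘P-invP ρ B)       ≈⟨ perm-fix _ _ (λ x _ → FinPerm.to-from ρ x) ⟩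
    id                                         ∎

  cancelˡ : ∀ {A B C} {f : Hom A B} {g : Hom B A} {h h' : Hom B C} →
            g ⨾ f ≈ id → f ⨾ h ≈ f ⨾ h' → h ≈ h'
  cancelˡ {f = f} {g} {h} {h'} g⨾f≈id f⨾h≈f⨾h' = begin
    h                ≈⟨ idˡ h ⟨
    id ⨾ h           ≈⟨ ⨾-cong g⨾f≈id ≈-refl ⟨
    (g ⨾ f) ⨾ h      ≈⟨ assoc g f h ⟩
    g ⨾ (f ⨾ h)      ≈⟨ ⨾-cong ≈-refl f⨾h≈f⨾h' ⟩
    g ⨾ (f ⨾ h')     ≈⟨ assoc g f h' ⟨
    (g ⨾ f) ⨾ h'     ≈⟨ ⨾-cong g⨾f≈id ≈-refl ⟩
    id ⨾ h'          ≈⟨ idˡ h' ⟩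
    h'               ∎

module NHomProperties {ℓ₁ ℓ₁' ℓ₂ ℓ₂'} {T : NominalPROP ℓ₁ ℓ₁'} {T' : NominalPROP ℓ₂ ℓ₂'}
                      (F : NHom T T') where
  open NHom F
  private
    module S = NominalPROP T
    module S' = NominalPROP T'
    module P = NominalPROPProperties T
    module P' = NominalPROPProperties T'
  open P'.HomReasoning

  -- Pick c outside the support of π and conjugate by a bijection δ : {c} → {x}:
  -- since π⁻¹ fixes c, equivariance of F at δ becomes
  -- F δ ; F(π_{x}) ≈ F δ ; π_{x}, and F δ is invertible.
  map-perm-singleton : ∀ π {x y} (i : Img π ⟦ x ⟧ ⟦ y ⟧) → map (S.perm π i) S'.≈ S'.perm π i
  map-perm-singleton π {x} i = P'.cancelˡ map-δ⁻¹⨾map-δ≈id map-δ⨾map-π≈map-δ⨾π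
    where
    c : Name
    c = FinPerm.bound π

    π⁻¹-fixes-c : ∀ z → z ∈ˢ ⟦ c ⟧ → FinPerm.to (invP π) z ≡ z
    π⁻¹-fixes-c _ (here refl) = FinPerm.support (invP π) c ≤-refl

    fix : Img (invP π) ⟦ c ⟧ ⟦ c ⟧
    fix = Img-⟦⟧ (invP π) (π⁻¹-fixes-c c (here refl))

    δ : S.Hom ⟦ c ⟧ ⟦ x ⟧
    δ = S.perm (transposeP c x) (Img-⟦⟧ _ (transpose-applyˡ c x))

    δ⁻¹ : S.Hom ⟦ x ⟧ ⟦ c ⟧
    δ⁻¹ = S.perm (invP (transposeP c x)) (Img-⟦⟧ _ (transpose-applyʳ c x))

    map-δ⁻¹⨾map-δ≈id : map δ⁻¹ S'.⨾ map δ S'.≈ S'.id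
    map-δ⁻¹⨾map-δ≈id = begin
      map δ⁻¹ S'.⨾ map δ   ≈⟨ map-⨾ δ⁻¹ δ ⟨
      map (δ⁻¹ S.⨾ δ)      ≈⟨ map-cong (P.perm-invˡ (transposeP c x) _ _) ⟩
      map S.id             ≈⟨ map-id ⟩
      S'.id                ∎

    map-fix≈id : map (S.perm (invP π) fix) S'.≈ S'.id
    map-fix≈id = begin
      map (S.perm (invP π) fix)   ≈⟨ map-cong (P.perm-fix (invP π) fix π⁻¹-fixes-c) ⟩
      map S.id                    ≈⟨ map-id ⟩
      S'.id                       ∎

    map-δ⨾map-π≈map-δ⨾π : map δ S'.⨾ map (S.perm π i) S'.≈ map δ S'.⨾ S'.perm π i
    map-δ⨾map-π≈map-δ⨾π = begin
      map δ S'.⨾ map (S.perm π i)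
        ≈⟨ S'.idˡ _ ⟨
      S'.id S'.⨾ (map δ S'.⨾ map (S.perm π i))
        ≈⟨ S'.⨾-cong map-fix≈id (map-⨾ δ (S.perm π i)) ⟨
      map (S.perm (invP π) fix) S'.⨾ map (δ S.⨾ S.perm π i)
        ≈⟨ map-⨾ _ _ ⟨
      map (act T π fix i δ)
        ≈⟨ map-equiv π fix i δ ⟩
      S'.perm (invP π) fix S'.⨾ (map δ S'.⨾ S'.perm π i)
        ≈⟨ S'.⨾-cong (P'.perm-fix (invP π) fix π⁻¹-fixes-c) P'.≈-refl ⟩
      S'.id S'.⨾ (map δ S'.⨾ S'.perm π i)
        ≈⟨ S'.idˡ _ ⟩
      map δ S'.⨾ S'.perm π i
        ∎

  map-ren : ∀ {n} {a b : Vec Name n} {A B} (r : Ren a b A B) → map (ren T r) S'.≈ ren T' r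
  map-ren ren[] = map-id
  map-ren (ren∷ π i p q r) = begin
    map (S.tensor (S.perm π i) (ren T r) p q)              ≈⟨ map-tensor _ _ p q ⟩
    S'.tensor (map (S.perm π i)) (map (ren T r)) p q       ≈⟨ S'.tensor-cong p q (map-perm-singleton π i) (map-ren r) ⟩
    S'.tensor (S'.perm π i) (ren T' r) p q                 ∎

  ordMap-cross : ∀ n → ordMap F (cross T n) ≡ cross T' n
  ordMap-cross zero = refl
  ordMap-cross (suc n) = cong (λ t → (idᵀ {n = 1} ⊕ t) ⨾ᵀ (σ ⊕ idᵀ)) (ordMap-cross n)

  ordMap-move : ∀ {n} (k : Fin (suc n)) → ordMap F (move T k) ≡ move T' k
  ordMap-move zero = refl
  ordMap-move {suc n} (suc k) = cong (λ t → (σ ⊕ idᵀ) ⨾ᵀ (idᵀ {n = 1} ⊕ t)) (ordMap-move k)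

  indexOf-independent : ∀ {n} x (v : Vec Name (suc n)) → indexOf T x v ≡ indexOf T' x v
  indexOf-independent x (y ∷ ys) with x ≟ y
  indexOf-independent x (y ∷ ys) | yes _ = refl
  indexOf-independent x (y ∷ []) | no _ = refl
  indexOf-independent x (y ∷ (z ∷ zs)) | no _ = cong suc (indexOf-independent x (z ∷ zs))

  ordMap-symᵀ : ∀ {n} (a a' : Vec Name n) → ordMap F (symᵀ T a a') ≡ symᵀ T' a a'
  ordMap-symᵀ [] [] = refl
  ordMap-symᵀ (x ∷ a) a' =
    trans (cong₂ (λ s m → (idᵀ {n = 1} ⊕ s) ⨾ᵀ m) (ordMap-symᵀ a _) (ordMap-move _))
          (cong (λ k → (idᵀ {n = 1} ⊕ symᵀ T' a (removeAt a' k)) ⨾ᵀ move T' k)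
                (indexOf-independent x a'))

  ordMap-resp-≈ᵀ : ∀ {n m n' m'} {t : Term T n m} {u : Term T n' m'} →
                   _≈ᵀ_ T t u → _≈ᵀ_ T' (ordMap F t) (ordMap F u)
  ordMap-resp-≈ᵀ ≈refl = ≈refl
  ordMap-resp-≈ᵀ (≈sym e) = ≈sym (ordMap-resp-≈ᵀ e)
  ordMap-resp-≈ᵀ (≈trans e e') = ≈trans (ordMap-resp-≈ᵀ e) (ordMap-resp-≈ᵀ e')
  ordMap-resp-≈ᵀ (⨾ᵀ-cong e e') = ⨾ᵀ-cong (ordMap-resp-≈ᵀ e) (ordMap-resp-≈ᵀ e')
  ordMap-resp-≈ᵀ (⊕-cong e e') = ⊕-cong (ordMap-resp-≈ᵀ e) (ordMap-resp-≈ᵀ e')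
  ordMap-resp-≈ᵀ (idˡᵀ f) = idˡᵀ _
  ordMap-resp-≈ᵀ (idʳᵀ f) = idʳᵀ _
  ordMap-resp-≈ᵀ (assocᵀ f g h) = assocᵀ _ _ _
  ordMap-resp-≈ᵀ (⊕-assoc f g h) = ⊕-assoc _ _ _
  ordMap-resp-≈ᵀ (⊕-unitˡ f) = ⊕-unitˡ _
  ordMap-resp-≈ᵀ (⊕-unitʳ f) = ⊕-unitʳ _
  ordMap-resp-≈ᵀ ⊕-id = ⊕-id
  ordMap-resp-≈ᵀ (⊕-interchange f g f' g') = ⊕-interchange _ _ _ _
  ordMap-resp-≈ᵀ σ-inv = σ-inv
  ordMap-resp-≈ᵀ σ-ybe = σ-ybe
  ordMap-resp-≈ᵀ (σ-nat {n} {m} f) =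
    subst₂ (λ c c' → _≈ᵀ_ T' ((ordMap F f ⊕ idᵀ) ⨾ᵀ c) (c' ⨾ᵀ (idᵀ ⊕ ordMap F f)))
           (sym (ordMap-cross m)) (sym (ordMap-cross n)) (σ-nat (ordMap F f))
  ordMap-resp-≈ᵀ (gen-cong a b ea eb e) = gen-cong a b ea eb (map-cong e)
  ordMap-resp-≈ᵀ (rel-⨾ a b c ea eb ec f g) =
    ≈trans (gen-cong a c ea ec (map-⨾ f g)) (rel-⨾ a b c ea eb ec _ _)
  ordMap-resp-≈ᵀ (rel-⊎ af bf ag bg eaf ebf eag ebg ea eb f g p q) =
    ≈trans (gen-cong _ _ ea eb (map-tensor f g p q))
           (rel-⊎ af bf ag bg eaf ebf eag ebg ea eb _ _ p q)
  ordMap-resp-≈ᵀ (rel-id a ea) = ≈trans (gen-cong a a ea ea map-id) (rel-id a ea)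
  ordMap-resp-≈ᵀ (rel-renˡ a a' b c r ea eb ec f) =
    ≈trans (gen-cong a c ea ec (P'.≈-trans (map-⨾ _ f) (S'.⨾-cong (map-ren r) P'.≈-refl)))
           (subst (λ s → _≈ᵀ_ T' _ (s ⨾ᵀ _)) (sym (ordMap-symᵀ a a'))
                  (rel-renˡ a a' b c r ea eb ec _))
  ordMap-resp-≈ᵀ (rel-renʳ a b c c' r ea eb ec' f) =
    ≈trans (gen-cong a c' ea ec' (P'.≈-trans (map-⨾ f _) (S'.⨾-cong P'.≈-refl (map-ren r))))
           (subst (λ s → _≈ᵀ_ T' _ (_ ⨾ᵀ s)) (sym (ordMap-symᵀ c c'))
                  (rel-renʳ a b c c' r ea eb ec' _))

  ordMap-isPROPArrow : IsPROPArrow T T' (ordMap F)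
  ordMap-isPROPArrow = record
    { resp = ordMap-resp-≈ᵀ ; pres-id = ≈refl ; pres-⨾ = λ _ _ → ≈refl
    ; pres-⊕ = λ _ _ → ≈refl ; pres-σ = ≈refl }

ordMap-idN : ∀ {ℓ ℓ'} (T : NominalPROP ℓ ℓ') {n m} (t : Term T n m) →
             _≈ᵀ_ T (ordMap (idN T) t) t
ordMap-idN T (gen a b ea eb f) = ≈refl
ordMap-idN T idᵀ = ≈refl
ordMap-idN T (t ⨾ᵀ u) = ⨾ᵀ-cong (ordMap-idN T t) (ordMap-idN T u)
ordMap-idN T (t ⊕ u) = ⊕-cong (ordMap-idN T t) (ordMap-idN T u)
ordMap-idN T σ = ≈refl

ordMap-∘N : ∀ {a a' b b' c c'} {T₁ : NominalPROP a a'} {T₂ : NominalPROP b b'}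
            {T₃ : NominalPROP c c'} (F : NHom T₁ T₂) (G : NHom T₂ T₃) {n m} (t : Term T₁ n m) →
            _≈ᵀ_ T₃ (ordMap (G ∘N F) t) (ordMap G (ordMap F t))
ordMap-∘N F G (gen a b ea eb f) = ≈refl
ordMap-∘N F G idᵀ = ≈refl
ordMap-∘N F G (t ⨾ᵀ u) = ⨾ᵀ-cong (ordMap-∘N F G t) (ordMap-∘N F G u)
ordMap-∘N F G (t ⊕ u) = ⊕-cong (ordMap-∘N F G t) (ordMap-∘N F G u)
ordMap-∘N F G σ = ≈refl

mainTheorem12 :
    ∀ {a a' b b' c c'} →
    -- ORD(F) is a well-defined arrow of PROPs ORD(T) → ORD(T'),
    -- given by ⟨a]f[b⟩ ↦ ⟨a]Ff[b⟩
    (∀ {T : NominalPROP a a'} {T' : NominalPROP b b'} (F : NHom T T') →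
       IsPROPArrow T T' (ordMap F))
    -- ORD preserves identities
    × (∀ (T : NominalPROP a a') {n m} (t : Term T n m) →
       _≈ᵀ_ T (ordMap (idN T) t) t)
    -- ORD preserves composition
    × (∀ {T₁ : NominalPROP a a'} {T₂ : NominalPROP b b'} {T₃ : NominalPROP c c'}
       (F : NHom T₁ T₂) (G : NHom T₂ T₃) {n m} (t : Term T₁ n m) →
       _≈ᵀ_ T₃ (ordMap (G ∘N F) t) (ordMap G (ordMap F t)))
mainTheorem12 = NHomProperties.ordMap-isPROPArrow , ordMap-idN , ordMap-∘N
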